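{- Let $r\ge 3$ and let $t$ be a positive integer with $2^t\le 2^{r-1}-2$. Then $(2^t+1)\text{ - }\mathrm{gp_e}(C_{2^r})=2^{t+1}$, where $C_{2^r}$ is the cycle on $2^r$ vertices.
   Context: A geodesic is a shortest path. For an integer $k\ge 3$, an edge $k$-general position set of a graph $G$ is a set $S\subseteq E(G)$ with $|S\cap E(P)|\le k-1$ for every geodesic $P$ of $G$; $k\text{ - }\mathrm{gp_e}(G)$ is the maximum cardinality of such a set. -}

module Defs where

open import Data.Nat using (ℕ; zero; suc; _+_; _∸_; _^_; _≤_; _<_; NonZero)
open import Data.Nat.DivMod using (_%_)
open import Data.Fin using (Fin; toℕ)
open import Data.List using (List; []; _∷_; length)
open import Data.List.Relation.Unary.All using (All)
open import Data.List.Relation.Unary.Unique.Propositional using (Unique)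
open import Data.List.Membership.Propositional using (_∈_)
open import Data.Product using (Σ; _×_; _,_; ∃)
open import Data.Sum using (_⊎_)
open import Relation.Binary.PropositionalEquality using (_≡_)

record Graph (n : ℕ) : Set₁ where
  field
    Adj : Fin n → Fin n → Set

open Graph public

module _ {n : ℕ} (G : Graph n) where

  data Consec : List (Fin n) → Fin n → Fin n → Set where
    here  : ∀ {x y zs} → Consec (x ∷ y ∷ zs) x y
    there : ∀ {z zs x y} → Consec zs x y → Consec (z ∷ zs) x y

  data Walk : Fin n → Fin n → List (Fin n) → Set where
    single : ∀ {u} → Walk u u (u ∷ [])
    step   : ∀ {u w v vs} → Adj G u w → Walk w v vs → Walk u v (u ∷ vs)

  IsPath : Fin n → Fin n → List (Fin n) → Set
  IsPath u v vs = Walk u v vs × Unique vs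

  walkLength : List (Fin n) → ℕ
  walkLength vs = length vs ∸ 1

  IsGeodesic : Fin n → Fin n → List (Fin n) → Set
  IsGeodesic u v vs =
    IsPath u v vs × (∀ ws → IsPath u v ws → walkLength vs ≤ walkLength ws)

  IsEdge : Fin n × Fin n → Set
  IsEdge (a , b) = toℕ a < toℕ b × Adj G a b

  EdgeOf : List (Fin n) → Fin n × Fin n → Set
  EdgeOf vs (a , b) = Consec vs a b ⊎ Consec vs b a

  IsEdgeSet : List (Fin n × Fin n) → Set
  IsEdgeSet S = Unique S × All IsEdge S

  -- |S ∩ E(P)| ≤ m : every duplicate-free list of edges lying both in S and
  -- in E(P) has at most m elements.
  InterAtMost : List (Fin n × Fin n) → List (Fin n) → ℕ → Set
  InterAtMost S vs m =
    ∀ (T : List (Fin n × Fin n)) → Unique T →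
      (∀ {e} → e ∈ T → e ∈ S × EdgeOf vs e) → length T ≤ m

  IsEdgeGP : ℕ → List (Fin n × Fin n) → Set
  IsEdgeGP k S =
    IsEdgeSet S × (∀ u v vs → IsGeodesic u v vs → InterAtMost S vs (k ∸ 1))

  EdgeGPNumber : ℕ → ℕ → Set
  EdgeGPNumber k m =
    (Σ (List (Fin n × Fin n)) λ S → IsEdgeGP k S × length S ≡ m) ×
    (∀ S → IsEdgeGP k S → length S ≤ m)

-- The cycle C_N on vertex set {0, …, N-1}: i ~ j iff j ≡ i+1 (mod N)
-- or i ≡ j+1 (mod N).  (Intended for N ≥ 3, where it is simple.)

cycleGraph : (N : ℕ) → .{{NonZero N}} → Graph N
cycleGraph N = record
  { Adj = λ i j → (toℕ j ≡ (toℕ i + 1) % N) ⊎ (toℕ i ≡ (toℕ j + 1) % N) }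

-- Write 2^r = 2Ks with K = 2^t, s ≥ 2, and let h = Ks be half the cycle length.
-- Upper bound: the two halves 0 → h and h → 0 of the cycle are geodesics covering every edge,
-- so an edge (K+1)-general position set has at most K edges on each of them.
-- Lower bound: take the 2K edges {is, is+1}. Every geodesic runs along an arc of at most h
-- steps; the marked edges on it sit at positions of a single residue class mod s among the
-- first Ks positions, and there are at most K such positions.

module Submission where

open import Defs
open import Data.Nat using (ℕ; _+_; _≤_; _∸_; _^_)
open import Data.Nat.Properties using (m^n≢0)

open import Data.Nat.Base using (zero; suc; _*_; _<_; NonZero; z≤n; s≤s; z<s; >-nonZero)
open import Data.Nat.Properties
  using ( +-assoc; +-comm; +-identityʳ; +-suc; +-cancelˡ-≡; +-mono-≤; +-mono-<; +-monoʳ-<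
        ; *-cancelʳ-≡; *-distribʳ-+; *-monoˡ-≤; ^-distribˡ-+-*; ^-monoʳ-≤; m^n>0; suc-pred
        ; <-irrefl; <-trans; <-≤-trans; ≤-<-trans; ≤-trans; ≤-reflexive; <⇒≤; <⇒≱; ≮⇒≥; ≰⇒>
        ; m≤m+n; m<m+n; m≤n*m; m≤n⇒m≤1+n; m+n≤o⇒m≤o; m+n≤o⇒m≤o∸n; m≤o∸n⇒m+n≤o; m<n+o⇒m∸n<o
        ; m+[n∸m]≡n; m∸n+n≡m; m+n∸n≡m; ∸-monoʳ-<; ∸-monoʳ-≤; ∸-monoˡ-≤
        ; _≤?_; _<?_; module ≤-Reasoning )
open import Data.Nat.DivMod
  using ( _%_; _/_; m%n<n; m%n≤m; m%n%n≡m%n; n%n≡0; [m+n]%n≡m%n; m<n⇒m%n≡m; %-distribˡ-+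
        ; %-remove-+ˡ; m∣n⇒o%n%m≡o%m; m≡m%n+[m/n]*n; m<n*o⇒m/o<n )
open import Data.Nat.Divisibility using (_∣_; n∣m*n; ∣m∣n⇒∣m+n)
open import Data.Nat.GeneralisedArithmetic using (iterate)
open import Data.Fin.Base using (Fin; toℕ; fromℕ<)
open import Data.Fin.Properties using (_≟_; toℕ-fromℕ<; toℕ-injective; toℕ<n)
open import Data.List.Base as List using (List; []; _∷_; length; map; filter; allFin)
open import Data.List.Properties using (length-removeAt′; length-iterate; length-map; length-upTo; length-tabulate)
open import Data.List.Relation.Unary.All as All using (All; []; _∷_)
open import Data.List.Relation.Unary.Any using (here; there; index; _─_)
open import Data.List.Relation.Unary.Unique.Propositional using (Unique)
open import Data.List.Relation.Unary.Unique.Propositional.Properties using (filter⁺; map⁺; allFin⁺)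
open import Data.List.Relation.Unary.AllPairs using ([]; _∷_)
open import Data.List.Membership.Propositional using (_∈_)
open import Data.List.Membership.Propositional.Properties using (∈-map⁻; ∈-filter⁻; ∈-upTo⁺; ∈-allFin)
open import Data.Product using (_×_; _,_; proj₁; proj₂; ∃)
open import Data.Sum using (_⊎_; inj₁; inj₂; [_,_]′)
import Data.Sum as Sum
open import Data.Empty using (⊥-elim)
open import Function.Base using (_∘_; id)
open import Relation.Nullary using (Dec; yes; no; _⊎-dec_)
open import Level using (0ℓ)
open import Relation.Unary using (Pred; Decidable)
open import Relation.Unary.Properties using (∁?)
open import Relation.Binary.PropositionalEquality
  using (_≡_; _≢_; refl; sym; trans; cong; cong₂; subst; subst₂; module ≡-Reasoning)

module _ {A : Set} where

  ∈-─⁺ : ∀ {x y : A} {ys} (p : x ∈ ys) → y ∈ ys → y ≢ x → y ∈ (ys ─ p)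
  ∈-─⁺ (here refl) (here refl) y≢x = ⊥-elim (y≢x refl)
  ∈-─⁺ (here _)    (there q)   _   = q
  ∈-─⁺ (there _)   (here y≡z)  _   = here y≡z
  ∈-─⁺ (there p)   (there q)   y≢x = there (∈-─⁺ p q y≢x)

  unique-⊆⇒length-≤ : ∀ {xs ys : List A} → Unique xs → (∀ {x} → x ∈ xs → x ∈ ys) →
                      length xs ≤ length ys
  unique-⊆⇒length-≤ {[]}     _              _     = z≤n
  unique-⊆⇒length-≤ {x ∷ xs} {ys} (x∉xs ∷ xs!) xs⊆ys = begin
    suc (length xs)       ≤⟨ s≤s (unique-⊆⇒length-≤ xs! xs⊆ys─x) ⟩
    suc (length (ys ─ p)) ≡⟨ length-removeAt′ ys (index p) ⟨
    length ys             ∎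
    where
    open ≤-Reasoning
    p : x ∈ ys
    p = xs⊆ys (here refl)
    xs⊆ys─x : ∀ {y} → y ∈ xs → y ∈ (ys ─ p)
    xs⊆ys─x q = ∈-─⁺ p (xs⊆ys (there q)) (All.lookup x∉xs q ∘ sym)

  unique-map⁺ : ∀ {B : Set} (f : A → B) {xs} → Unique xs →
                (∀ {x y} → x ∈ xs → y ∈ xs → f x ≡ f y → x ≡ y) → Unique (map f xs)
  unique-map⁺ f {[]}     []           _   = []
  unique-map⁺ f {x ∷ xs} (x∉xs ∷ xs!) inj =
    All.tabulate fx∉ ∷ unique-map⁺ f xs! (λ p q → inj (there p) (there q))
    where
    fx∉ : ∀ {b} → b ∈ map f xs → f x ≢ b
    fx∉ q fx≡b with ∈-map⁻ f q
    ... | y , y∈xs , refl = All.lookup x∉xs y∈xs (inj (here refl) (there y∈xs) fx≡b)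

  length-filter-∁ : ∀ {P : Pred A 0ℓ} (P? : Decidable P) xs →
                    length (filter P? xs) + length (filter (∁? P?) xs) ≡ length xs
  length-filter-∁ P? []       = refl
  length-filter-∁ P? (x ∷ xs) with P? x
  ... | yes _ = cong suc (length-filter-∁ P? xs)
  ... | no  _ = trans (+-suc _ _) (cong suc (length-filter-∁ P? xs))

m+m≤n+n⇒m≤n : ∀ {m n} → m + m ≤ n + n → m ≤ n
m+m≤n+n⇒m≤n {m} {n} m+m≤n+n with m ≤? n
... | yes m≤n = m≤n
... | no  m≰n = ⊥-elim (<⇒≱ (+-mono-< (≰⇒> m≰n) (≰⇒> m≰n)) m+m≤n+n)

unique-Fin-length-≤ : ∀ {n} {xs : List (Fin n)} → Unique xs → length xs ≤ n
unique-Fin-length-≤ {n} {xs} xs! = subst (length xs ≤_) (length-tabulate {n = n} id)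
  (unique-⊆⇒length-≤ xs! (λ {x} _ → ∈-allFin x))

unique-<-length-≤ : ∀ {K js} → Unique js → All (_< K) js → length js ≤ K
unique-<-length-≤ {K} {js} js! js<K = subst (length js ≤_) (length-upTo K)
  (unique-⊆⇒length-≤ js! (∈-upTo⁺ ∘ All.lookup js<K))

-- The quotients j / s tell apart the j that share a residue mod s.
residue-class-length : ∀ {K s ρ js} .{{_ : NonZero s}} → Unique js →
                       All (λ j → j < K * s × j % s ≡ ρ) js → length js ≤ K
residue-class-length {K} {s} {ρ} {js} js! bounds = begin
  length js              ≡⟨ length-map (_/ s) js ⟨
  length (map (_/ s) js) ≤⟨ unique-<-length-≤ (unique-map⁺ (_/ s) js! quotient-injective)
                                              (All.tabulate quotient<K) ⟩
  K                      ∎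
  where
  open ≤-Reasoning
  quotient<K : ∀ {q} → q ∈ map (_/ s) js → q < K
  quotient<K q∈ with ∈-map⁻ (_/ s) q∈
  ... | j , j∈js , refl = m<n*o⇒m/o<n (proj₁ (All.lookup bounds j∈js))
  quotient-injective : ∀ {i j} → i ∈ js → j ∈ js → i / s ≡ j / s → i ≡ j
  quotient-injective {i} {j} i∈ j∈ i/s≡j/s = begin-equality
    i                   ≡⟨ m≡m%n+[m/n]*n i s ⟩
    i % s + (i / s) * s ≡⟨ cong₂ (λ r q → r + q * s) same-residue i/s≡j/s ⟩
    j % s + (j / s) * s ≡⟨ m≡m%n+[m/n]*n j s ⟨
    j                   ∎
    where
    same-residue : i % s ≡ j % s
    same-residue = trans (proj₂ (All.lookup bounds i∈)) (sym (proj₂ (All.lookup bounds j∈)))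

module _ {A : Set} (f : A → A) where

  iterate-+ : ∀ x m k → iterate f x (m + k) ≡ iterate f (iterate f x m) k
  iterate-+ x zero    k = refl
  iterate-+ x (suc m) k = iterate-+ (f x) m k

  iterate-suc : ∀ x k → iterate f (f x) k ≡ f (iterate f x k)
  iterate-suc x zero    = refl
  iterate-suc x (suc k) = iterate-suc (f x) k

  iterate-inverse : ∀ {g : A → A} → (∀ x → g (f x) ≡ x) → ∀ x k → iterate g (iterate f x k) k ≡ x
  iterate-inverse {g} g∘f x zero    = refl
  iterate-inverse {g} g∘f x (suc k) = begin
    iterate g (g (iterate f (f x) k)) k ≡⟨ cong (λ y → iterate g (g y) k) (iterate-suc x k) ⟩
    iterate g (g (f (iterate f x k))) k ≡⟨ cong (λ y → iterate g y k) (g∘f (iterate f x k)) ⟩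
    iterate g (iterate f x k) k         ≡⟨ iterate-inverse g∘f x k ⟩
    x                                   ∎
    where open ≡-Reasoning

  -- u , f u , … , f^L u  (L steps, L + 1 vertices)
  arc : A → ℕ → List A
  arc u L = List.iterate f u (suc L)

  ∈-arc⁻ : ∀ {x u} L → x ∈ arc u L → ∃ λ j → j ≤ L × x ≡ iterate f u j
  ∈-arc⁻ zero    (here x≡u) = 0 , z≤n , x≡u
  ∈-arc⁻ (suc L) (here x≡u) = 0 , z≤n , x≡u
  ∈-arc⁻ (suc L) (there x∈) with ∈-arc⁻ L x∈
  ... | j , j≤L , x≡ = suc j , s≤s j≤L , x≡

  arc-unique : ∀ {u} L → (∀ x {k} → 0 < k → k ≤ L → iterate f x k ≢ x) → Unique (arc u L)
  arc-unique         zero    _         = [] ∷ []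
  arc-unique {u = u} (suc L) aperiodic =
    All.tabulate u∉ ∷ arc-unique L (λ x 0<k k≤L → aperiodic x 0<k (m≤n⇒m≤1+n k≤L))
    where
    u∉ : ∀ {x} → x ∈ arc (f u) L → u ≢ x
    u∉ x∈ u≡x with ∈-arc⁻ L x∈
    ... | j , j≤L , x≡ = aperiodic u (s≤s z≤n) (s≤s j≤L) (sym (trans u≡x x≡))

module _ {n : ℕ} (G : Graph n) where

  consec? : ∀ xs (x y : Fin n) → Dec (Consec G xs x y)
  consec? []           x y = no λ ()
  consec? (_ ∷ [])     x y = no λ { (there ()) }
  consec? (a ∷ b ∷ zs) x y with a ≟ x | b ≟ y | consec? (b ∷ zs) x y
  ... | yes refl | yes refl | _     = yes here
  ... | _        | _        | yes c = yes (there c)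
  ... | no a≢x   | _        | no ¬c = no λ { here → a≢x refl ; (there c) → ¬c c }
  ... | yes _    | no b≢y   | no ¬c = no λ { here → b≢y refl ; (there c) → ¬c c }

  edgeOf? : ∀ vs e → Dec (EdgeOf G vs e)
  edgeOf? vs (a , b) = consec? vs a b ⊎-dec consec? vs b a

  -- S splits into the edges on P and the rest, which lie on Q.
  two-geodesics-bound : ∀ {k S u v P u′ v′ Q} → IsGeodesic G u v P → IsGeodesic G u′ v′ Q →
                        (∀ {e} → IsEdge G e → EdgeOf G P e ⊎ EdgeOf G Q e) →
                        IsEdgeGP G k S → length S ≤ (k ∸ 1) + (k ∸ 1)
  two-geodesics-bound {k} {S} {u} {v} {P} {u′} {v′} {Q} P-geo Q-geo cover ((S! , S-edges) , gp) = begin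
    length S                 ≡⟨ length-filter-∁ (edgeOf? P) S ⟨
    length onP + length offP ≤⟨ +-mono-≤ (gp u v P P-geo onP (filter⁺ _ S!) (∈-filter⁻ (edgeOf? P)))
                                          (gp u′ v′ Q Q-geo offP (filter⁺ _ S!) offP⊆Q) ⟩
    (k ∸ 1) + (k ∸ 1)        ∎
    where
    open ≤-Reasoning
    onP offP : List (Fin n × Fin n)
    onP  = filter (edgeOf? P) S
    offP = filter (∁? (edgeOf? P)) S
    offP⊆Q : ∀ {e} → e ∈ offP → e ∈ S × EdgeOf G Q e
    offP⊆Q e∈ with ∈-filter⁻ (∁? (edgeOf? P)) e∈
    ... | e∈S , e∉P = e∈S , [ ⊥-elim ∘ e∉P , id ]′ (cover (All.lookup S-edges e∈S))

  walk-arc : ∀ {f : Fin n → Fin n} → (∀ x → Adj G x (f x)) → ∀ u L → Walk G u (iterate f u L) (arc f u L)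
  walk-arc f-adj u zero    = single
  walk-arc f-adj u (suc L) = step (f-adj u) (walk-arc f-adj _ L)

  walkLength-arc : ∀ f u L → walkLength G (arc f u L) ≡ L
  walkLength-arc f u L = length-iterate f (f u) L

  consec-arc⁻ : ∀ {f : Fin n → Fin n} {a b} u L → Consec G (arc f u L) a b →
                ∃ λ j → j < L × a ≡ iterate f u j × b ≡ f a
  consec-arc⁻ u zero          (there ())
  consec-arc⁻ u (suc L)       here      = 0 , s≤s z≤n , refl , refl
  consec-arc⁻ u (suc L)       (there c) with consec-arc⁻ _ L c
  ... | j , j<L , a≡ , b≡ = suc j , s≤s j<L , a≡ , b≡

  consec-arc⁺ : ∀ {f : Fin n → Fin n} u {j L} → j < L → Consec G (arc f u L) (iterate f u j) (f (iterate f u j))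
  consec-arc⁺ u {zero}  {suc L} _         = here
  consec-arc⁺ u {suc j} {suc L} (s≤s j<L) = there (consec-arc⁺ _ j<L)

  walk-head : ∀ {x v xs} → Walk G x v xs → x ∈ xs
  walk-head single     = here refl
  walk-head (step _ _) = here refl

  -- A path that has stepped from u to f u can never step back, so it follows f.
  arc-continues : ∀ {f g : Fin n → Fin n} → (∀ x → g (f x) ≡ x) →
                  (∀ {x y} → Adj G x y → y ≡ f x ⊎ y ≡ g x) →
                  ∀ {u v ws} → Walk G (f u) v ws → All (u ≢_) ws → Unique ws →
                  ∃ λ L → ws ≡ arc f (f u) L × v ≡ iterate f (f u) L
  arc-continues g∘f adj single _ _ = 0 , refl , refl
  arc-continues g∘f adj {u} (step a rest) (_ ∷ u∉) (fu∉ ∷ rest!) with adj a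
  ... | inj₁ refl with arc-continues g∘f adj rest fu∉ rest!
  ...   | L , refl , refl = suc L , refl , refl
  arc-continues g∘f adj {u} (step a rest) (_ ∷ u∉) _ | inj₂ refl =
    ⊥-elim (All.lookup u∉ (walk-head rest) (sym (g∘f u)))

  path-along-arc : ∀ {f g : Fin n → Fin n} → (∀ x → f (g x) ≡ x) → (∀ x → g (f x) ≡ x) →
                   (∀ {x y} → Adj G x y → y ≡ f x ⊎ y ≡ g x) →
                   ∀ {u v vs} → Walk G u v vs → Unique vs →
                   ∃ λ L → (vs ≡ arc f u L × v ≡ iterate f u L) ⊎ (vs ≡ arc g u L × v ≡ iterate g u L)
  path-along-arc f∘g g∘f adj single _ = 0 , inj₁ (refl , refl)
  path-along-arc f∘g g∘f adj (step a rest) (u∉ ∷ rest!) with adj a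
  ... | inj₁ refl with arc-continues g∘f adj rest u∉ rest!
  ...   | L , refl , refl = suc L , inj₁ (refl , refl)
  path-along-arc f∘g g∘f adj (step a rest) (u∉ ∷ rest!) | inj₂ refl
    with arc-continues f∘g (Sum.swap ∘ adj) rest u∉ rest!
  ...   | L , refl , refl = suc L , inj₂ (refl , refl)

module Cycle (N : ℕ) (2<N : 2 < N) where

  instance
    N≢0 : NonZero N
    N≢0 = >-nonZero (<-trans z<s 2<N)

  G : Graph N
  G = cycleGraph N

  next prev : Fin N → Fin N
  next x = fromℕ< (m%n<n (toℕ x + 1) N)
  prev x = iterate next x (N ∸ 1)

  %-absorbˡ : ∀ m k → (m % N + k) % N ≡ (m + k) % N
  %-absorbˡ m k = begin
    (m % N + k) % N           ≡⟨ %-distribˡ-+ (m % N) k N ⟩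
    (m % N % N + k % N) % N   ≡⟨ cong (λ r → (r + k % N) % N) (m%n%n≡m%n m N) ⟩
    (m % N + k % N) % N       ≡⟨ %-distribˡ-+ m k N ⟨
    (m + k) % N               ∎
    where open ≡-Reasoning

  toℕ-iterate-next : ∀ x k → toℕ (iterate next x k) ≡ (toℕ x + k) % N
  toℕ-iterate-next x zero    = sym (trans (cong (_% N) (+-identityʳ (toℕ x))) (m<n⇒m%n≡m (toℕ<n x)))
  toℕ-iterate-next x (suc k) = begin
    toℕ (iterate next (next x) k) ≡⟨ toℕ-iterate-next (next x) k ⟩
    (toℕ (next x) + k) % N        ≡⟨ cong (λ m → (m + k) % N) (toℕ-fromℕ< _) ⟩
    ((toℕ x + 1) % N + k) % N     ≡⟨ %-absorbˡ (toℕ x + 1) k ⟩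
    (toℕ x + 1 + k) % N           ≡⟨ cong (_% N) (+-assoc (toℕ x) 1 k) ⟩
    (toℕ x + suc k) % N           ∎
    where open ≡-Reasoning

  iterate-next-≡ : ∀ {x y} k → (toℕ x + k) % N ≡ toℕ y → iterate next x k ≡ y
  iterate-next-≡ {x} k eq = toℕ-injective (trans (toℕ-iterate-next x k) eq)

  next-period : ∀ x → iterate next x N ≡ x
  next-period x = iterate-next-≡ N (trans ([m+n]%n≡m%n (toℕ x) N) (m<n⇒m%n≡m (toℕ<n x)))

  next-aperiodic : ∀ x {k} → 0 < k → k < N → iterate next x k ≢ x
  next-aperiodic x {k} 0<k k<N x+k≡x = not-multiple ((toℕ x + k) / N) k≡qN
    where
    x+k≡x%N : (toℕ x + k) % N ≡ toℕ x
    x+k≡x%N = trans (sym (toℕ-iterate-next x k)) (cong toℕ x+k≡x)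
    k≡qN : k ≡ ((toℕ x + k) / N) * N
    k≡qN = +-cancelˡ-≡ (toℕ x) _ _
      (trans (m≡m%n+[m/n]*n (toℕ x + k) N) (cong (_+ ((toℕ x + k) / N) * N) x+k≡x%N))
    not-multiple : ∀ q → k ≢ q * N
    not-multiple zero    k≡0    = <-irrefl (sym k≡0) 0<k
    not-multiple (suc q) k≡qN+N = <⇒≱ k<N (subst (N ≤_) (sym k≡qN+N) (m≤m+n N _))

  prev-next : ∀ x → prev (next x) ≡ x
  prev-next x = trans (cong (iterate next x) (suc-pred N)) (next-period x)

  next-prev : ∀ x → next (prev x) ≡ x
  next-prev x = trans (sym (iterate-suc next x (N ∸ 1))) (prev-next x)

  prev-period : ∀ x → iterate prev x N ≡ x
  prev-period x = trans (cong (λ y → iterate prev y N) (sym (next-period x))) (iterate-inverse next prev-next x N)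

  prev-aperiodic : ∀ x {k} → 0 < k → k < N → iterate prev x k ≢ x
  prev-aperiodic x {k} 0<k k<N x-k≡x = next-aperiodic x 0<k k<N (begin
    iterate next x k                    ≡⟨ cong (λ y → iterate next y k) x-k≡x ⟨
    iterate next (iterate prev x k) k   ≡⟨ iterate-inverse prev next-prev x k ⟩
    x                                   ∎)
    where open ≡-Reasoning

  next-adj : ∀ x → Adj G x (next x)
  next-adj x = inj₁ (toℕ-fromℕ< _)

  prev-adj : ∀ x → Adj G x (prev x)
  prev-adj x = inj₂ (trans (cong toℕ (sym (next-prev x))) (toℕ-fromℕ< _))

  adj-cases : ∀ {x y} → Adj G x y → y ≡ next x ⊎ y ≡ prev x
  adj-cases (inj₁ y≡x+1) = inj₁ (toℕ-injective (trans y≡x+1 (sym (toℕ-fromℕ< _))))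
  adj-cases {x} {y} (inj₂ x≡y+1) =
    inj₂ (trans (sym (prev-next y)) (cong prev (toℕ-injective (trans (toℕ-fromℕ< _) (sym x≡y+1)))))

  next-next-≢ : ∀ x → next (next x) ≢ x
  next-next-≢ x = next-aperiodic x {2} (s≤s z≤n) 2<N

  path-arc : ∀ {u v vs} → IsPath G u v vs →
             ∃ λ L → (vs ≡ arc next u L × v ≡ iterate next u L)
                   ⊎ (vs ≡ arc prev u L × v ≡ iterate prev u L)
  path-arc (walk , vs!) = path-along-arc G next-prev prev-next adj-cases walk vs!

  -- The position of a on the arc that starts at w and follows next.
  offset : Fin N → Fin N → ℕ
  offset w a = (toℕ a + (N ∸ toℕ w)) % N

  iterate-next-offset : ∀ w a → iterate next w (offset w a) ≡ a
  iterate-next-offset w a = iterate-next-≡ (offset w a) (begin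
    (toℕ w + offset w a) % N            ≡⟨ cong (_% N) (+-comm (toℕ w) (offset w a)) ⟩
    (offset w a + toℕ w) % N            ≡⟨ %-absorbˡ (toℕ a + (N ∸ toℕ w)) (toℕ w) ⟩
    (toℕ a + (N ∸ toℕ w) + toℕ w) % N   ≡⟨ cong (_% N) (+-assoc (toℕ a) _ _) ⟩
    (toℕ a + ((N ∸ toℕ w) + toℕ w)) % N ≡⟨ cong (λ m → (toℕ a + m) % N) (m∸n+n≡m (<⇒≤ (toℕ<n w))) ⟩
    (toℕ a + N) % N                     ≡⟨ [m+n]%n≡m%n (toℕ a) N ⟩
    toℕ a % N                           ≡⟨ m<n⇒m%n≡m (toℕ<n a) ⟩
    toℕ a                               ∎)
    where open ≡-Reasoning

  offset-iterate-next : ∀ w {k} → k < N → offset w (iterate next w k) ≡ k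
  offset-iterate-next w {k} k<N = begin
    (toℕ (iterate next w k) + (N ∸ toℕ w)) % N ≡⟨ cong (λ m → (m + (N ∸ toℕ w)) % N) (toℕ-iterate-next w k) ⟩
    ((toℕ w + k) % N + (N ∸ toℕ w)) % N        ≡⟨ %-absorbˡ (toℕ w + k) (N ∸ toℕ w) ⟩
    (toℕ w + k + (N ∸ toℕ w)) % N              ≡⟨ cong (_% N) (+-comm (toℕ w + k) _) ⟩
    ((N ∸ toℕ w) + (toℕ w + k)) % N            ≡⟨ cong (_% N) (+-assoc (N ∸ toℕ w) (toℕ w) k) ⟨
    ((N ∸ toℕ w) + toℕ w + k) % N              ≡⟨ cong (λ m → (m + k) % N) (m∸n+n≡m (<⇒≤ (toℕ<n w))) ⟩
    (N + k) % N                                ≡⟨ cong (_% N) (+-comm N k) ⟩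
    (k + N) % N                                ≡⟨ [m+n]%n≡m%n k N ⟩
    k % N                                      ≡⟨ m<n⇒m%n≡m k<N ⟩
    k                                          ∎
    where open ≡-Reasoning

  offset-injective : ∀ w {a b} → offset w a ≡ offset w b → a ≡ b
  offset-injective w {a} {b} eq =
    trans (sym (iterate-next-offset w a)) (trans (cong (iterate next w) eq) (iterate-next-offset w b))

  ascending-arc-edge : ∀ {w a} L → L < N → EdgeOf G (arc next w L) (a , next a) → offset w a < L
  ascending-arc-edge {w} L L<N (inj₁ c) with consec-arc⁻ G w L c
  ... | j , j<L , refl , _ = subst (_< L) (sym (offset-iterate-next w (<-trans j<L L<N))) j<L
  ascending-arc-edge {w} {a} L L<N (inj₂ c) with consec-arc⁻ G w L c
  ... | _ , _ , _ , a≡ = ⊥-elim (next-next-≢ a (sym a≡))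

  -- A descending arc traversed backwards is the ascending arc from its far end.
  descending-arc-edge : ∀ {u a} L → L < N → EdgeOf G (arc prev u L) (a , next a) →
                        offset (iterate prev u L) a < L
  descending-arc-edge {u} {a} L L<N (inj₁ c) with consec-arc⁻ G u L c
  ... | _ , _ , _ , next-a≡prev-a =
    ⊥-elim (next-next-≢ a (trans (cong next next-a≡prev-a) (next-prev a)))
  descending-arc-edge {u} {a} L L<N (inj₂ c) with consec-arc⁻ G u L c
  ... | j , j<L , next-a≡ , a≡ = subst (_< L) (sym offset≡m) m<L
    where
    m : ℕ
    m = L ∸ suc j
    m<L : m < L
    m<L = ∸-monoʳ-< z<s j<L
    a-on-arc : a ≡ iterate prev u (suc j)
    a-on-arc = trans a≡ (trans (cong prev next-a≡) (sym (iterate-suc prev u j)))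
    far-end : iterate prev u L ≡ iterate prev a m
    far-end = begin
      iterate prev u L                            ≡⟨ cong (iterate prev u) (m+[n∸m]≡n j<L) ⟨
      iterate prev u (suc j + m)                  ≡⟨ iterate-+ prev u (suc j) m ⟩
      iterate prev (iterate prev u (suc j)) m     ≡⟨ cong (λ y → iterate prev y m) a-on-arc ⟨
      iterate prev a m                            ∎
      where open ≡-Reasoning
    offset≡m : offset (iterate prev u L) a ≡ m
    offset≡m = begin
      offset (iterate prev u L) a    ≡⟨ cong (λ w → offset w a) far-end ⟩
      offset w a                     ≡⟨ cong (offset w) (iterate-inverse prev next-prev a m) ⟨
      offset w (iterate next w m)    ≡⟨ offset-iterate-next w (<-trans m<L L<N) ⟩
      m                              ∎
      where
        open ≡-Reasoning
        w : Fin N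
        w = iterate prev a m

  module Opposite {f g : Fin N → Fin N} (g∘f : ∀ x → g (f x) ≡ x) (f-period : ∀ x → iterate f x N ≡ x)
                  (g-adj : ∀ x → Adj G x (g x))
                  (g-aperiodic : ∀ x {k} → 0 < k → k < N → iterate g x k ≢ x) where

    opposite-endpoint : ∀ u {L} → L ≤ N → iterate g u (N ∸ L) ≡ iterate f u L
    opposite-endpoint u {L} L≤N = begin
      iterate g u (N ∸ L)                                 ≡⟨ cong (λ y → iterate g y (N ∸ L)) around ⟨
      iterate g (iterate f (iterate f u L) (N ∸ L)) (N ∸ L) ≡⟨ iterate-inverse f g∘f _ (N ∸ L) ⟩
      iterate f u L                                       ∎
      where
      open ≡-Reasoning
      around : iterate f (iterate f u L) (N ∸ L) ≡ u
      around = trans (sym (iterate-+ f u L (N ∸ L))) (trans (cong (iterate f u) (m+[n∸m]≡n L≤N)) (f-period u))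

    -- The arc along g with N ∸ L steps has the same endpoints.
    geodesic-arc-length : ∀ {u} L → IsGeodesic G u (iterate f u L) (arc f u L) → L + L ≤ N
    geodesic-arc-length         zero      _                     = z≤n
    geodesic-arc-length {u} L@(suc _) ((_ , arc!) , shortest) =
      m≤o∸n⇒m+n≤o L (<⇒≤ L<N) (subst₂ _≤_ (walkLength-arc G f u L) (walkLength-arc G g u (N ∸ L))
        (shortest (arc g u (N ∸ L)) (opposite-walk , opposite-unique)))
      where
      L<N : L < N
      L<N = subst (_≤ N) (length-iterate f u (suc L)) (unique-Fin-length-≤ arc!)
      opposite-walk : Walk G u (iterate f u L) (arc g u (N ∸ L))
      opposite-walk = subst (λ v → Walk G u v (arc g u (N ∸ L))) (opposite-endpoint u (<⇒≤ L<N))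
        (walk-arc G g-adj u (N ∸ L))
      opposite-unique : Unique (arc g u (N ∸ L))
      opposite-unique = arc-unique g (N ∸ L)
        (λ x 0<k k≤ → g-aperiodic x 0<k (≤-<-trans k≤ (∸-monoʳ-< z<s (<⇒≤ L<N))))

  module Ascending  = Opposite prev-next next-period prev-adj prev-aperiodic
  module Descending = Opposite next-prev prev-period next-adj next-aperiodic

module EvenCycle (h : ℕ) (2≤h : 2 ≤ h) where

  open Cycle (h + h) (≤-trans (s≤s (s≤s (s≤s z≤n))) (+-mono-≤ 2≤h 2≤h)) public

  h<h+h : h < h + h
  h<h+h = m<m+n h (<-≤-trans z<s 2≤h)

  geodesic-window : ∀ {u v vs} → IsGeodesic G u v vs →
                    ∃ λ w → ∃ λ L → L ≤ h × (∀ {a} → EdgeOf G vs (a , next a) → offset w a < L)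
  geodesic-window {u} geo@(path , _) with path-arc path
  ... | L , inj₁ (refl , refl) = u , L , L≤h , ascending-arc-edge L (≤-<-trans L≤h h<h+h)
    where
    L≤h : L ≤ h
    L≤h = m+m≤n+n⇒m≤n (Ascending.geodesic-arc-length L geo)
  ... | L , inj₂ (refl , refl) = iterate prev u L , L , L≤h , descending-arc-edge L (≤-<-trans L≤h h<h+h)
    where
    L≤h : L ≤ h
    L≤h = m+m≤n+n⇒m≤n (Descending.geodesic-arc-length L geo)

  origin antipode : Fin (h + h)
  origin   = fromℕ< (<-≤-trans z<s (≤-trans 2≤h (m≤m+n h h)))
  antipode = fromℕ< h<h+h

  toℕ-origin : toℕ origin ≡ 0
  toℕ-origin = toℕ-fromℕ< _

  toℕ-antipode : toℕ antipode ≡ h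
  toℕ-antipode = toℕ-fromℕ< _

  antipodal : ∀ {x y} → toℕ x ≡ 0 → toℕ y ≡ h → ∀ M →
              (iterate next x M ≡ y → h ≤ M) × (iterate next y M ≡ x → h ≤ M)
  antipodal {x} {y} x≡0 y≡h M = x→y , y→x
    where
    x→y : iterate next x M ≡ y → h ≤ M
    x→y x+M≡y = subst (_≤ M) M%N≡h (m%n≤m M (h + h))
      where
      M%N≡h : M % (h + h) ≡ h
      M%N≡h = trans (cong (λ m → (m + M) % (h + h)) (sym x≡0))
                (trans (sym (toℕ-iterate-next x M)) (trans (cong toℕ x+M≡y) y≡h))
    y→x : iterate next y M ≡ x → h ≤ M
    y→x y+M≡x with h ≤? M
    ... | yes h≤M = h≤M
    ... | no  h≰M = ⊥-elim (<⇒≱ (<-≤-trans z<s 2≤h) (m+n≤o⇒m≤o h (≤-reflexive h+M≡0)))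
      where
      h+M≡0 : h + M ≡ 0
      h+M≡0 = begin
        h + M                     ≡⟨ m<n⇒m%n≡m (+-monoʳ-< h (≰⇒> h≰M)) ⟨
        (h + M) % (h + h)         ≡⟨ cong (λ m → (m + M) % (h + h)) y≡h ⟨
        (toℕ y + M) % (h + h)     ≡⟨ toℕ-iterate-next y M ⟨
        toℕ (iterate next y M)    ≡⟨ cong toℕ y+M≡x ⟩
        toℕ x                     ≡⟨ x≡0 ⟩
        0                         ∎
        where open ≡-Reasoning

  half-arc-geodesic : ∀ {u v} → iterate next u h ≡ v →
                      (∀ M → iterate next u M ≡ v → h ≤ M) → (∀ M → iterate next v M ≡ u → h ≤ M) →
                      IsGeodesic G u v (arc next u h)
  half-arc-geodesic {u} {v} u+h≡v forward backward =
    (subst (λ y → Walk G u y (arc next u h)) u+h≡v (walk-arc G next-adj u h) , arc!) , shortest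
    where
    arc! : Unique (arc next u h)
    arc! = arc-unique next h (λ x 0<k k≤h → next-aperiodic x 0<k (≤-<-trans k≤h h<h+h))
    shortest : ∀ ws → IsPath G u v ws → walkLength G (arc next u h) ≤ walkLength G ws
    shortest ws path with path-arc path
    ... | M , inj₁ (refl , v≡) =
      subst₂ _≤_ (sym (walkLength-arc G next u h)) (sym (walkLength-arc G next u M)) (forward M (sym v≡))
    ... | M , inj₂ (refl , v≡) =
      subst₂ _≤_ (sym (walkLength-arc G next u h)) (sym (walkLength-arc G prev u M))
        (backward M (trans (cong (λ y → iterate next y M) v≡) (iterate-inverse prev next-prev u M)))

  origin-half antipode-half : List (Fin (h + h))
  origin-half   = arc next origin h
  antipode-half = arc next antipode h

  origin-half-geodesic : IsGeodesic G origin antipode origin-half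
  origin-half-geodesic = half-arc-geodesic
    (iterate-next-≡ h (trans (cong (λ m → (m + h) % (h + h)) toℕ-origin)
                             (trans (m<n⇒m%n≡m h<h+h) (sym toℕ-antipode))))
    (proj₁ ∘ antipodal toℕ-origin toℕ-antipode) (proj₂ ∘ antipodal toℕ-origin toℕ-antipode)

  antipode-half-geodesic : IsGeodesic G antipode origin antipode-half
  antipode-half-geodesic = half-arc-geodesic
    (iterate-next-≡ h (trans (cong (λ m → (m + h) % (h + h)) toℕ-antipode)
                             (trans (n%n≡0 (h + h)) (sym toℕ-origin))))
    (proj₂ ∘ antipodal toℕ-origin toℕ-antipode) (proj₁ ∘ antipodal toℕ-origin toℕ-antipode)

  next-edge-on-half : ∀ x → Consec G origin-half x (next x) ⊎ Consec G antipode-half x (next x)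
  next-edge-on-half x with toℕ x <? h
  ... | yes x<h = inj₁ (subst (λ y → Consec G origin-half y (next y)) x≡ (consec-arc⁺ G origin x<h))
    where
    x≡ : iterate next origin (toℕ x) ≡ x
    x≡ = iterate-next-≡ (toℕ x)
      (trans (cong (λ m → (m + toℕ x) % (h + h)) toℕ-origin) (m<n⇒m%n≡m (toℕ<n x)))
  ... | no  x≮h = inj₂ (subst (λ y → Consec G antipode-half y (next y)) x≡ (consec-arc⁺ G antipode x∸h<h))
    where
    h≤x : h ≤ toℕ x
    h≤x = ≮⇒≥ x≮h
    x∸h<h : toℕ x ∸ h < h
    x∸h<h = m<n+o⇒m∸n<o (toℕ x) h {{>-nonZero (<-≤-trans z<s 2≤h)}} (toℕ<n x)
    x≡ : iterate next antipode (toℕ x ∸ h) ≡ x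
    x≡ = iterate-next-≡ (toℕ x ∸ h) (begin
      (toℕ antipode + (toℕ x ∸ h)) % (h + h) ≡⟨ cong (λ m → (m + (toℕ x ∸ h)) % (h + h)) toℕ-antipode ⟩
      (h + (toℕ x ∸ h)) % (h + h)            ≡⟨ cong (_% (h + h)) (m+[n∸m]≡n h≤x) ⟩
      toℕ x % (h + h)                        ≡⟨ m<n⇒m%n≡m (toℕ<n x) ⟩
      toℕ x                                  ∎)
      where open ≡-Reasoning

  halves-cover : ∀ {e} → IsEdge G e → EdgeOf G origin-half e ⊎ EdgeOf G antipode-half e
  halves-cover {a , b} (_ , a~b) with adj-cases a~b
  ... | inj₁ refl = Sum.map inj₁ inj₁ (next-edge-on-half a)
  ... | inj₂ refl = Sum.map (inj₂ ∘ prev-a~a) (inj₂ ∘ prev-a~a) (next-edge-on-half (prev a))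
    where
    prev-a~a : ∀ {P} → Consec G P (prev a) (next (prev a)) → Consec G P (prev a) a
    prev-a~a = subst (Consec G _ (prev a)) (next-prev a)

  edgeGP-length-≤ : ∀ {k S} → IsEdgeGP G k S → length S ≤ (k ∸ 1) + (k ∸ 1)
  edgeGP-length-≤ {k} = two-geodesics-bound G {k} origin-half-geodesic antipode-half-geodesic halves-cover

module MarkedEdges (K s : ℕ) (1≤K : 1 ≤ K) (2≤s : 2 ≤ s) where

  instance
    s≢0 : NonZero s
    s≢0 = >-nonZero (<-≤-trans z<s 2≤s)

  open EvenCycle (K * s) (≤-trans 2≤s (m≤n*m s K {{>-nonZero 1≤K}}))

  N : ℕ
  N = K * s + K * s

  [is+1]<N : ∀ (i : Fin (K + K)) → toℕ i * s + 1 < N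
  [is+1]<N i = begin-strict
    toℕ i * s + 1     <⟨ +-monoʳ-< (toℕ i * s) 2≤s ⟩
    toℕ i * s + s     ≡⟨ +-comm (toℕ i * s) s ⟩
    suc (toℕ i) * s   ≤⟨ *-monoˡ-≤ s (toℕ<n i) ⟩
    (K + K) * s       ≡⟨ *-distribʳ-+ s K K ⟩
    N                 ∎
    where open ≤-Reasoning

  marked : Fin (K + K) → Fin N
  marked i = fromℕ< (≤-<-trans (m≤m+n (toℕ i * s) 1) ([is+1]<N i))

  toℕ-marked : ∀ i → toℕ (marked i) ≡ toℕ i * s
  toℕ-marked i = toℕ-fromℕ< _

  markedEdge : Fin (K + K) → Fin N × Fin N
  markedEdge i = marked i , next (marked i)

  markedEdge-injective : ∀ {i j} → markedEdge i ≡ markedEdge j → i ≡ j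
  markedEdge-injective {i} {j} eq = toℕ-injective (*-cancelʳ-≡ (toℕ i) (toℕ j) s
    (trans (sym (toℕ-marked i)) (trans (cong (toℕ ∘ proj₁) eq) (toℕ-marked j))))

  markedEdge-isEdge : ∀ i → IsEdge G (markedEdge i)
  markedEdge-isEdge i = subst₂ _<_ (sym (toℕ-marked i)) (sym toℕ-next) (m<m+n (toℕ i * s) z<s) , next-adj (marked i)
    where
    toℕ-next : toℕ (next (marked i)) ≡ toℕ i * s + 1
    toℕ-next = trans (toℕ-fromℕ< _) (trans (cong (λ m → (m + 1) % N) (toℕ-marked i)) (m<n⇒m%n≡m ([is+1]<N i)))

  S : List (Fin N × Fin N)
  S = map markedEdge (allFin (K + K))

  ∈S⁻ : ∀ {e} → e ∈ S → ∃ λ a → e ≡ (a , next a) × s ∣ toℕ a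
  ∈S⁻ e∈S with ∈-map⁻ markedEdge e∈S
  ... | i , _ , refl = marked i , refl , subst (s ∣_) (sym (toℕ-marked i)) (n∣m*n (toℕ i))

  S-isEdgeSet : IsEdgeSet G S
  S-isEdgeSet = map⁺ markedEdge-injective (allFin⁺ (K + K)) , All.tabulate isEdge
    where
    isEdge : ∀ {e} → e ∈ S → IsEdge G e
    isEdge e∈S with ∈-map⁻ markedEdge e∈S
    ... | i , _ , refl = markedEdge-isEdge i

  S-length : length S ≡ K + K
  S-length = trans (length-map markedEdge (allFin (K + K))) (length-tabulate {n = K + K} id)

  offset-marked-residue : ∀ w {a} → s ∣ toℕ a → offset w a % s ≡ (N ∸ toℕ w) % s
  offset-marked-residue w {a} s∣a =
    trans (m∣n⇒o%n%m≡o%m s N _ (∣m∣n⇒∣m+n (n∣m*n K) (n∣m*n K))) (%-remove-+ˡ (N ∸ toℕ w) s∣a)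

  geodesic-meets-S : ∀ {u v vs} → IsGeodesic G u v vs → InterAtMost G S vs K
  geodesic-meets-S geo T T! T⊆S∩vs with geodesic-window geo
  ... | w , L , L≤Ks , window = begin
    length T                ≡⟨ length-map position T ⟨
    length (map position T) ≤⟨ residue-class-length (unique-map⁺ position T! position-injective)
                                                    (All.tabulate position-bounds) ⟩
    K                       ∎
    where
    open ≤-Reasoning
    position : Fin N × Fin N → ℕ
    position e = offset w (proj₁ e)
    position-injective : ∀ {e e′} → e ∈ T → e′ ∈ T → position e ≡ position e′ → e ≡ e′
    position-injective e∈T e′∈T eq with ∈S⁻ (proj₁ (T⊆S∩vs e∈T)) | ∈S⁻ (proj₁ (T⊆S∩vs e′∈T))
    ... | _ , refl , _ | _ , refl , _ = cong (λ a → a , next a) (offset-injective w eq)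
    position-bounds : ∀ {j} → j ∈ map position T → j < K * s × j % s ≡ (N ∸ toℕ w) % s
    position-bounds j∈ with ∈-map⁻ position j∈
    ... | e , e∈T , refl with T⊆S∩vs e∈T
    ...   | e∈S , e-on-vs with ∈S⁻ e∈S
    ...     | _ , refl , s∣a = <-≤-trans (window e-on-vs) L≤Ks , offset-marked-residue w s∣a

  S-isEdgeGP : IsEdgeGP G (K + 1) S
  S-isEdgeGP = S-isEdgeSet , λ _ _ vs geo →
    subst (InterAtMost G S vs) (sym (m+n∸n≡m K 1)) (geodesic-meets-S geo)

  edgeGPNumber : EdgeGPNumber G (K + 1) (K + K)
  edgeGPNumber = (S , S-isEdgeGP , S-length) ,
    λ S′ gp → subst (λ m → length S′ ≤ m + m) (m+n∸n≡m K 1) (edgeGP-length-≤ {K + 1} gp)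

cycle-edgeGPNumber : ∀ K s → 1 ≤ K → 2 ≤ s → ∀ N .{{_ : NonZero N}} → N ≡ K * s + K * s →
                     EdgeGPNumber (cycleGraph N) (K + 1) (K + K)
cycle-edgeGPNumber K s 1≤K 2≤s _ refl = MarkedEdges.edgeGPNumber K s 1≤K 2≤s

lemma3p1 : ∀ (r t : ℕ) → 3 ≤ r → 1 ≤ t → 2 ^ t ≤ 2 ^ (r ∸ 1) ∸ 2 →
    EdgeGPNumber (cycleGraph (2 ^ r) {{m^n≢0 2 r}}) (2 ^ t + 1) (2 ^ (t + 1))
lemma3p1 r t _ _ 2^t≤2^[r-1]-2 =
  subst (EdgeGPNumber (cycleGraph (2 ^ r) {{m^n≢0 2 r}}) (2 ^ t + 1)) (sym 2^[t+1]≡)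
    (cycle-edgeGPNumber (2 ^ t) (2 ^ a) (m^n>0 2 t) (^-monoʳ-≤ 2 1≤a) (2 ^ r) {{m^n≢0 2 r}} 2^r≡)
  where
  t+1<r : suc t < r
  t+1<r with suc t <? r
  ... | yes t+1<r = t+1<r
  ... | no  t+1≮r = ⊥-elim (<-irrefl refl (begin-strict
    2 ^ (r ∸ 1)       ≤⟨ ^-monoʳ-≤ 2 (∸-monoˡ-≤ 1 (≮⇒≥ t+1≮r)) ⟩
    2 ^ t             ≤⟨ 2^t≤2^[r-1]-2 ⟩
    2 ^ (r ∸ 1) ∸ 2   ≤⟨ ∸-monoʳ-≤ (2 ^ (r ∸ 1)) (s≤s z≤n) ⟩
    2 ^ (r ∸ 1) ∸ 1   <⟨ ∸-monoʳ-< z<s (m^n>0 2 (r ∸ 1)) ⟩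
    2 ^ (r ∸ 1)       ∎))
    where open ≤-Reasoning
  a : ℕ
  a = r ∸ suc t
  1≤a : 1 ≤ a
  1≤a = m+n≤o⇒m≤o∸n 1 {suc t} t+1<r
  2^r≡ : 2 ^ r ≡ 2 ^ t * 2 ^ a + 2 ^ t * 2 ^ a
  2^r≡ = begin
    2 ^ r                             ≡⟨ cong (2 ^_) (m+[n∸m]≡n (<⇒≤ t+1<r)) ⟨
    2 ^ (t + a) + (2 ^ (t + a) + 0)   ≡⟨ cong (2 ^ (t + a) +_) (+-identityʳ _) ⟩
    2 ^ (t + a) + 2 ^ (t + a)         ≡⟨ cong (λ m → m + m) (^-distribˡ-+-* 2 t a) ⟩
    2 ^ t * 2 ^ a + 2 ^ t * 2 ^ a     ∎
    where open ≡-Reasoning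
  2^[t+1]≡ : 2 ^ (t + 1) ≡ 2 ^ t + 2 ^ t
  2^[t+1]≡ = begin
    2 ^ (t + 1)           ≡⟨ cong (2 ^_) (+-comm t 1) ⟩
    2 ^ t + (2 ^ t + 0)   ≡⟨ cong (2 ^ t +_) (+-identityʳ _) ⟩
    2 ^ t + 2 ^ t         ∎
    where open ≡-Reasoning
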